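{- There is no universal coalition path; that is, there is no positive integer $k$ such that every one of the $18$ graphs $K_1$, $K_2$, $\overline{K_2}$, $K_1\cup K_2$, $P_3$, $K_3$, $K_{1,3}$, $2K_2$, $P_4$, $C_4$, $F_1$, $K_4-e$, $P_2\cup P_3$, $F_2$, $B_1$, $P_5$, $S(1,2)$, $S(2,2)$ is isomorphic to $\mathrm{CG}(P_k,\Psi)$ for some coalition partition $\Psi$ of the path $P_k$.
   Context: For a graph $G$ with vertex set $V$, a set $S\subseteq V$ is a dominating set if every vertex of $V\setminus S$ is adjacent to a vertex of $S$. Two disjoint sets $V_1,V_2\subseteq V$ form a coalition in $G$ if neither is a dominating set of $G$ but $V_1\cup V_2$ is. A coalition partition of $G$ is a partition $\Psi=\{V_1,\ldots,V_k\}$ of $V$ such that every $V_i\in\Psi$ is either a dominating set of $G$ with $|V_i|=1$, or is not a dominating set and forms a coalition with some $V_j\in\Psi$. Given a coalition partition $\Psi$ of $G$, the coalition graph $\mathrm{CG}(G,\Psi)$ has vertex set $\Psi$, two members adjacent iff they form a coalition in $G$. $P_k$ is the path on $k$ vertices. Graphs: $F_1$ is a triangle with one pendant edge; $F_2$ is a $4$-cycle with one pendant edge; $B_1$ (the bull) is a triangle with pendant edges at two distinct vertices; $S(r,s)$ is the double star, a tree with exactly two adjacent non-leaf vertices having $r$ and $s$ leaf neighbors; $K_4-e$ is $K_4$ minus an edge; $2K_2$ is two disjoint edges; $\overline{K_2}$ is two isolated vertices; $\cup$ denotes disjoint union. -}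

module Defs where

open import Data.Nat using (ℕ; suc; _+_; _≤_)
open import Data.Fin using (Fin; toℕ; #_)
open import Data.List using (List; []; _∷_)
open import Data.List.Membership.Propositional using (_∈_)
open import Data.Product using (Σ; ∃; _×_; _,_)
open import Data.Sum using (_⊎_)
open import Relation.Nullary using (¬_)
open import Relation.Binary.PropositionalEquality using (_≡_; _≢_)
open import Function.Bundles using (_⇔_; _↔_; Inverse)

record Graph : Set where
  constructor mkGraph
  field
    order : ℕ
    edges : List (Fin order × Fin order)
open Graph public

Adj : (G : Graph) → Fin (order G) → Fin (order G) → Set
Adj G u v = ((u , v) ∈ edges G) ⊎ ((v , u) ∈ edges G)

PathAdj : (k : ℕ) → Fin k → Fin k → Set
PathAdj k u v = (suc (toℕ u) ≡ toℕ v) ⊎ (suc (toℕ v) ≡ toℕ u)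

Subset : ℕ → Set₁
Subset k = Fin k → Set

_∪_ : ∀ {k} → Subset k → Subset k → Subset k
(S ∪ T) v = S v ⊎ T v

Dominating : (k : ℕ) → Subset k → Set
Dominating k S = ∀ v → S v ⊎ (Σ (Fin k) λ u → S u × PathAdj k v u)

-- A partition of V(P_k) into m (nonempty) classes, encoded by a surjective label map.
Surjective : ∀ {k m} → (Fin k → Fin m) → Set
Surjective {k} {m} f = ∀ (i : Fin m) → Σ (Fin k) λ v → f v ≡ i

Class : ∀ {k m} → (Fin k → Fin m) → Fin m → Subset k
Class f i v = f v ≡ i

SingletonClass : ∀ {k m} → (Fin k → Fin m) → Fin m → Set
SingletonClass {k} f i = Σ (Fin k) λ v → (f v ≡ i) × (∀ w → f w ≡ i → w ≡ v)

-- V_i and V_j (i ≠ j, hence disjoint) form a coalition in P_k.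
Coalition : ∀ {k m} → (Fin k → Fin m) → Fin m → Fin m → Set
Coalition {k} f i j =
  (i ≢ j) × ¬ Dominating k (Class f i) × ¬ Dominating k (Class f j)
  × Dominating k (Class f i ∪ Class f j)

IsCoalitionPartition : ∀ {k m} → (Fin k → Fin m) → Set
IsCoalitionPartition {k} {m} f =
  Surjective f ×
  (∀ i → (Dominating k (Class f i) × SingletonClass f i)
       ⊎ (¬ Dominating k (Class f i) × Σ (Fin m) λ j → Coalition f i j))

RealizedByPath : ℕ → Graph → Set
RealizedByPath k H =
  Σ ℕ λ m → Σ (Fin k → Fin m) λ f → IsCoalitionPartition f ×
    Σ (Fin m ↔ Fin (order H)) λ σ →
      ∀ i j → Adj H (Inverse.to σ i) (Inverse.to σ j) ⇔ Coalition f i j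

K1 K2 coK2 K1∪K2 P3 K3 K13 twoK2 P4 C4 F1 K4-e P2∪P3 F2 B1 P5 S12 S22 : Graph
K1    = mkGraph 1 []
K2    = mkGraph 2 ((# 0 , # 1) ∷ [])
coK2  = mkGraph 2 []
K1∪K2 = mkGraph 3 ((# 1 , # 2) ∷ [])
P3    = mkGraph 3 ((# 0 , # 1) ∷ (# 1 , # 2) ∷ [])
K3    = mkGraph 3 ((# 0 , # 1) ∷ (# 1 , # 2) ∷ (# 0 , # 2) ∷ [])
K13   = mkGraph 4 ((# 0 , # 1) ∷ (# 0 , # 2) ∷ (# 0 , # 3) ∷ [])
twoK2 = mkGraph 4 ((# 0 , # 1) ∷ (# 2 , # 3) ∷ [])
P4    = mkGraph 4 ((# 0 , # 1) ∷ (# 1 , # 2) ∷ (# 2 , # 3) ∷ [])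
C4    = mkGraph 4 ((# 0 , # 1) ∷ (# 1 , # 2) ∷ (# 2 , # 3) ∷ (# 3 , # 0) ∷ [])
-- triangle 0,1,2 with pendant 3 at 2
F1    = mkGraph 4 ((# 0 , # 1) ∷ (# 1 , # 2) ∷ (# 0 , # 2) ∷ (# 2 , # 3) ∷ [])
K4-e  = mkGraph 4 ((# 0 , # 1) ∷ (# 0 , # 2) ∷ (# 0 , # 3) ∷ (# 1 , # 2) ∷ (# 1 , # 3) ∷ [])
P2∪P3 = mkGraph 5 ((# 0 , # 1) ∷ (# 2 , # 3) ∷ (# 3 , # 4) ∷ [])
-- 4-cycle 0123 with pendant 4 at 0
F2    = mkGraph 5 ((# 0 , # 1) ∷ (# 1 , # 2) ∷ (# 2 , # 3) ∷ (# 3 , # 0) ∷ (# 0 , # 4) ∷ [])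
-- bull: triangle 0,1,2, pendants 3 at 0 and 4 at 1
B1    = mkGraph 5 ((# 0 , # 1) ∷ (# 1 , # 2) ∷ (# 0 , # 2) ∷ (# 0 , # 3) ∷ (# 1 , # 4) ∷ [])
P5    = mkGraph 5 ((# 0 , # 1) ∷ (# 1 , # 2) ∷ (# 2 , # 3) ∷ (# 3 , # 4) ∷ [])
-- double star S(1,2): centres 0 (leaf 2) and 1 (leaves 3,4)
S12   = mkGraph 5 ((# 0 , # 1) ∷ (# 0 , # 2) ∷ (# 1 , # 3) ∷ (# 1 , # 4) ∷ [])
-- double star S(2,2): centres 0 (leaves 2,3) and 1 (leaves 4,5)
S22   = mkGraph 6 ((# 0 , # 1) ∷ (# 0 , # 2) ∷ (# 0 , # 3) ∷ (# 1 , # 4) ∷ (# 1 , # 5) ∷ [])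

targets : List Graph
targets = K1 ∷ K2 ∷ coK2 ∷ K1∪K2 ∷ P3 ∷ K3 ∷ K13 ∷ twoK2 ∷ P4 ∷ C4 ∷ F1 ∷ K4-e ∷ P2∪P3 ∷ F2 ∷ B1 ∷ P5 ∷ S12 ∷ S22 ∷ []

-- A realization of K₁ has a single class, which cannot have a coalition partner,
-- so it is a dominating singleton and the path has one vertex; a realization of K₂
-- has two nonempty classes, so the path has at least two vertices.
module Submission where

open import Defs
open import Data.Nat as ℕ using (ℕ; _≤_; s≤s)
open import Data.Nat.Properties using (≤-trans; ≤⇒≯)
open import Data.Fin using (Fin; zero)
open import Data.Fin.Properties using (injective⇒≤)
open import Data.Product using (Σ; _×_; _,_; proj₁; proj₂)
open import Data.Sum using (inj₁; inj₂)
open import Data.List.Relation.Unary.All using (All; _∷_)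
open import Relation.Nullary using (¬_; contradiction)
open import Relation.Binary.PropositionalEquality using (_≡_; refl; sym; trans; cong)
open import Function.Bundles using (_↔_; Injection)
open import Function.Properties.Inverse using (↔⇒↣; ↔-sym)

private
  variable
    k m : ℕ

Fin-subsingleton : m ≤ 1 → (i j : Fin m) → i ≡ j
Fin-subsingleton {1}               _        zero zero = refl
Fin-subsingleton {ℕ.suc (ℕ.suc _)} (s≤s ()) _    _

subsingleton⇒≤1 : ((i j : Fin m) → i ≡ j) → m ≤ 1
subsingleton⇒≤1 {m} all-equal = injective⇒≤ {f = λ (_ : Fin m) → zero} λ {i} {j} _ → all-equal i j

↔⇒≤ : Fin m ↔ Fin k → m ≤ k
↔⇒≤ σ = injective⇒≤ (Injection.injective (↔⇒↣ σ))

surjective⇒≤ : {f : Fin k → Fin m} → Surjective f → m ≤ k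
surjective⇒≤ {k} {m} {f} surj = injective⇒≤ {f = section} section-injective
  where
    section : Fin m → Fin k
    section i = proj₁ (surj i)

    section-injective : ∀ {i j} → section i ≡ section j → i ≡ j
    section-injective {i} {j} eq =
      trans (sym (proj₂ (surj i))) (trans (cong f eq) (proj₂ (surj j)))

single-class-partition⇒≤1 : {f : Fin k → Fin m} → m ≤ 1 → IsCoalitionPartition f → k ≤ 1
single-class-partition⇒≤1 {f = f} m≤1 (_ , classify) = subsingleton⇒≤1 all-equal
  where
    same-class : ∀ i j → i ≡ j
    same-class = Fin-subsingleton m≤1

    all-equal : ∀ v w → v ≡ w
    all-equal v w with classify (f v)
    ... | inj₁ (_ , u , _ , only-u) = trans (only-u v refl) (sym (only-u w (same-class (f w) (f v))))
    ... | inj₂ (_ , j , i≢j , _)    = contradiction (same-class (f v) j) i≢j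

realized⇒order≤ : ∀ {H} → RealizedByPath k H → order H ≤ k
realized⇒order≤ (_ , _ , (surj , _) , σ , _) = ≤-trans (↔⇒≤ (↔-sym σ)) (surjective⇒≤ surj)

realized-K1⇒≤1 : RealizedByPath k K1 → k ≤ 1
realized-K1⇒≤1 (_ , _ , partition , σ , _) = single-class-partition⇒≤1 (↔⇒≤ σ) partition

theorem11 : ¬ (Σ ℕ λ k → (1 ≤ k) × All (RealizedByPath k) targets)
theorem11 (_ , _ , by-K1 ∷ by-K2 ∷ _) = ≤⇒≯ (realized-K1⇒≤1 by-K1) (realized⇒order≤ by-K2)
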